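{- Let $1\le s<t\le n$ be integers and $0<m<\binom{n}{s}$. Let $m+1=[n_s,n_{s-1},\dots,n_{s-\ell+1}]_s$ be the strict $s$-cascade representation of $m+1$, of length $\ell$. Then $k^t_s(m+1)>k^t_s(m)$ if and only if $t\le\ell+n_{s-\ell+1}-1$.
   Context: For an $s$-graph (a set of $s$-subsets of a finite set) and $t\ge s$, a $t$-clique is a $t$-set all of whose $s$-subsets are edges, and $k^t$ counts $t$-cliques. Colex order on finite subsets of $\mathbb{N}$: $A<B$ iff $\max(A\triangle B)\in B$; $\mathbb{C}^{(s)}(m)$ is the $s$-graph formed by the first $m$ $s$-subsets of $\mathbb{N}$ in colex order, and $k^t_s(m)=k^t(\mathbb{C}^{(s)}(m))$. For a strictly decreasing integer sequence $(n_s,\dots,n_{s-\ell+1})$, $[n_s,\dots,n_{s-\ell+1}]_s=\sum_{k=0}^{\ell-1}\binom{n_{s-k}}{s-k}$; it is a strict $s$-cascade if $\ell\le s$ and $n_{s-k}\ge s-k$ for all $k$; every $m\ge0$ has a unique such representation with a strict $s$-cascade. -}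

module Defs where

open import Data.Bool using (Bool; true; false; not; if_then_else_)
open import Data.Nat using (ℕ; zero; suc; _+_; _∸_; _⊔_; _≡ᵇ_; _<ᵇ_)
open import Data.List using (List; []; _∷_; _++_; map; length; upTo; foldr)
open import Data.Bool.ListAction using (all; any)
open import Data.Maybe using (Maybe; nothing; just)

-- Finite subsets of ℕ are represented by lists of distinct naturals.

_∈ᵇ_ : ℕ → List ℕ → Bool
x ∈ᵇ xs = any (λ y → x ≡ᵇ y) xs

bfilter : {A : Set} → (A → Bool) → List A → List A
bfilter p [] = []
bfilter p (x ∷ xs) = if p x then x ∷ bfilter p xs else bfilter p xs

symdiff : List ℕ → List ℕ → List ℕ
symdiff A B = bfilter (λ x → not (x ∈ᵇ B)) A ++ bfilter (λ x → not (x ∈ᵇ A)) B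

maxM : List ℕ → Maybe ℕ
maxM [] = nothing
maxM (x ∷ xs) with maxM xs
... | nothing = just x
... | just y  = just (x ⊔ y)

colexLt : List ℕ → List ℕ → Bool
colexLt A B with maxM (symdiff A B)
... | nothing = false
... | just x  = x ∈ᵇ B

subsets : ℕ → List ℕ → List (List ℕ)
subsets zero xs = [] ∷ []
subsets (suc k) [] = []
subsets (suc k) (x ∷ xs) = map (x ∷_) (subsets k xs) ++ subsets (suc k) xs

maxℕ : List ℕ → ℕ
maxℕ = foldr _⊔_ 0

-- colex rank of an s-set A among s-subsets of ℕ: the number of s-subsets
-- B of ℕ with B <colex A.  (Every such B satisfies max B ≤ max A, so it
-- suffices to enumerate the s-subsets of {0,…,max A}.)
rank : ℕ → List ℕ → ℕ
rank s A = length (bfilter (λ B → colexLt B A) (subsets s (upTo (suc (maxℕ A)))))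

-- edge test of C^(s)(m): an s-set A is an edge iff it is among the first m
-- s-subsets of ℕ in colex order, i.e. its colex rank is < m.
isEdgeC : ℕ → ℕ → List ℕ → Bool
isEdgeC s m A = rank s A <ᵇ m

isCliqueC : ℕ → ℕ → List ℕ → Bool
isCliqueC s m T = all (isEdgeC s m) (subsets s T)

-- For s ≥ 1 every vertex of
-- C^(s)(m) is < m + s (an s-set with maximum x has colex rank ≥ x - s + 1),
-- so every t-clique (t ≥ s) is a t-subset of {0,…,m+s-1}.
k[_,_] : ℕ → ℕ → ℕ → ℕ
k[ t , s ] m = length (bfilter (isCliqueC s m) (subsets t (upTo (m + s))))

{-# OPTIONS --safe #-}
-- Write an s-set as a decreasing list x₁ > ⋯ > x_s; its colex rank (the number of s-sets
-- before it in colex order) is Σᵢ C(xᵢ, s−i+1).  By the hockey-stick identity the cascade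
-- of m + 1 therefore names the s-set of rank m, i.e. the edge added from C^(s)(m) to
-- C^(s)(m+1): it is n_s, …, n_{s−ℓ+2} followed by the p = s−ℓ+1 largest numbers below
-- c = n_{s−ℓ+1}.  A new t-clique must contain this edge while all its s-subsets rank at
-- most m; so the edge is formed by its top s vertices and the other t − s vertices lie
-- below c − p, whence t ≤ ℓ − 1 + c.  Conversely, if t ≤ ℓ − 1 + c, the edge together with
-- the next t − s numbers below it is a new clique, as lowering vertices lowers colex rank.
module Submission where

open import Defs
open import Data.Nat using (ℕ; zero; suc; _+_; _∸_; _<_; _≤_)
open import Data.Nat.Combinatorics using (_C_)
open import Data.Fin using (Fin; toℕ; fromℕ)
open import Data.List using (tabulate)
open import Data.Nat.ListAction using (sum)
open import Data.Product using (_×_)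
open import Function.Bundles using (_⇔_)
open import Relation.Binary.PropositionalEquality using (_≡_)

open import Data.Bool using (Bool; true; false; not; T; _∨_)
open import Data.Bool.Properties using (∨-assoc; ∨-identityʳ; ∨-zeroʳ; T-≡)
open import Data.Empty using (⊥-elim)
open import Data.Fin using (inject₁) renaming (zero to fzero; suc to fsuc)
open import Data.Fin.Properties using (toℕ-fromℕ; toℕ-inject₁; toℕ<n)
open import Data.List
  using (List; []; _∷_; _++_; [_]; length; map; take; upTo; downFrom; reverse)
open import Data.List.Properties
  using ( ++-identityʳ; ++-assoc; length-++; length-map; length-take; length-tabulate
        ; length-upTo; length-downFrom; length-reverse; unfold-reverse; reverse-++
        ; reverse-upTo; reverse-downFrom; reverse-involutive; upTo-∷ʳ )
open import Data.List.Membership.Propositional using (_∈_)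
open import Data.List.Membership.Propositional.Properties
  using (∈-++⁺ˡ; ∈-++⁺ʳ; ∈-++⁻; ∈-map⁺; ∈-map⁻)
open import Data.List.Relation.Binary.Permutation.Propositional using (↭-sym)
open import Data.List.Relation.Binary.Permutation.Propositional.Properties
  using (All-resp-↭; ↭-reverse)
open import Data.List.Relation.Binary.Sublist.Propositional
  using (_⊆_; []; _∷_; _∷ʳ_; minimum; ⊆-refl; ⊆-trans)
open import Data.List.Relation.Binary.Sublist.Propositional.Properties
  using (All-resp-⊆; length-mono-≤; reverse⁺; take⁺; take-⊆; ++⁺; ++⁺ˡ)
open import Data.List.Relation.Unary.All as All using (All; []; _∷_)
open import Data.List.Relation.Unary.All.Properties as All using (all-upTo; all⁺; all⁻)
open import Data.List.Relation.Unary.AllPairs as AllPairs using (AllPairs; []; _∷_)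
open import Data.List.Relation.Unary.AllPairs.Properties as AllPairs using ()
open import Data.List.Relation.Unary.Any using (here; there)
open import Data.Maybe using (just; nothing)
open import Data.Nat
open import Data.Nat.Properties
open import Data.Nat.Combinatorics using (nC1≡n; nCk+nC[k+1]≡[n+1]C[k+1])
open import Algebra.Properties.CommutativeSemigroup +-commutativeSemigroup using ()
  renaming (interchange to +-interchange)
open import Data.Product using (∃-syntax; _,_; proj₁; uncurry)
open import Data.Sum using (_⊎_; inj₁; inj₂)
open import Function using (_∘_; flip)
open import Function.Bundles using (Equivalence; mk⇔)
open import Relation.Binary.Definitions using (tri<; tri≈; tri>)
open import Relation.Binary.PropositionalEquality hiding ([_])
open import Relation.Nullary using (¬_; contradiction)
open import Relation.Nullary.Decidable using (decidable-stable)

-- Binomial coefficients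

nCk≤[n+1]Ck : ∀ k n → n C k ≤ suc n C k
nCk≤[n+1]Ck zero    n = ≤-refl
nCk≤[n+1]Ck (suc k) n = begin
  n C suc k               ≤⟨ m≤n+m _ _ ⟩
  n C k + n C suc k       ≡⟨ nCk+nC[k+1]≡[n+1]C[k+1] n k ⟩
  suc n C suc k           ∎
  where open ≤-Reasoning

C-monoˡ-≤ : ∀ k {m n} → m ≤ n → m C k ≤ n C k
C-monoˡ-≤ k m≤n = go (≤⇒≤′ m≤n)
  where
  go : ∀ {n} → _ ≤′ n → _ C k ≤ n C k
  go ≤′-refl         = ≤-refl
  go (≤′-step m≤′n)  = ≤-trans (go m≤′n) (nCk≤[n+1]Ck k _)

m<[m+k]Ck : ∀ m {k} → 1 ≤ k → m < (m + k) C k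
m<[m+k]Ck m {suc zero}    _ = ≤-reflexive (sym (trans (nC1≡n (m + 1)) (+-comm m 1)))
m<[m+k]Ck m {suc (suc k)} _ = begin-strict
  m                                           <⟨ m<[m+k]Ck m {suc k} (s≤s z≤n) ⟩
  (m + suc k) C suc k                         ≤⟨ m≤m+n _ _ ⟩
  (m + suc k) C suc k + (m + suc k) C suc (suc k)
    ≡⟨ nCk+nC[k+1]≡[n+1]C[k+1] (m + suc k) (suc k) ⟩
  suc (m + suc k) C suc (suc k)               ≡⟨ cong (_C suc (suc k)) (sym (+-suc m (suc k))) ⟩
  (m + suc (suc k)) C suc (suc k)             ∎
  where open ≤-Reasoning

-- Decreasing lists and their colex rank

Descending : List ℕ → Set
Descending = AllPairs _>_

Descending-resp-⊆ : ∀ {xs ys} → xs ⊆ ys → Descending ys → Descending xs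
Descending-resp-⊆ []          []        = []
Descending-resp-⊆ (_ ∷ʳ xs⊆)  (_ ∷ ys↓) = Descending-resp-⊆ xs⊆ ys↓
Descending-resp-⊆ (refl ∷ xs⊆) (y>ys ∷ ys↓) = All-resp-⊆ xs⊆ y>ys ∷ Descending-resp-⊆ xs⊆ ys↓

Descending⇒length≤ : ∀ {xs b} → Descending xs → All (_< b) xs → length xs ≤ b
Descending⇒length≤ []          []          = z≤n
Descending⇒length≤ (x>xs ∷ xs↓) (x<b ∷ _) = ≤-trans (s≤s (Descending⇒length≤ xs↓ x>xs)) x<b

Descending-downFrom : ∀ n → Descending (downFrom n)
Descending-downFrom n = AllPairs.applyDownFrom⁺₁ (λ i → i) n (λ j<i _ → j<i)

colexRank : List ℕ → ℕ
colexRank []       = 0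
colexRank (x ∷ xs) = x C suc (length xs) + colexRank xs

colexRank<C : ∀ {xs y} → Descending xs → All (_< y) xs → colexRank xs < y C length xs
colexRank<C []                   []          = s≤s z≤n
colexRank<C {x ∷ xs} {y} (x>xs ∷ xs↓) (x<y ∷ _) = begin-strict
  x C suc (length xs) + colexRank xs  <⟨ +-monoʳ-< _ (colexRank<C xs↓ x>xs) ⟩
  x C suc (length xs) + x C length xs ≡⟨ +-comm (x C suc (length xs)) _ ⟩
  x C length xs + x C suc (length xs) ≡⟨ nCk+nC[k+1]≡[n+1]C[k+1] x (length xs) ⟩
  suc x C suc (length xs)             ≤⟨ C-monoˡ-≤ (suc (length xs)) x<y ⟩
  y C suc (length xs)                 ∎
  where open ≤-Reasoning

colexRank-<-head : ∀ {x y xs ys} → Descending (x ∷ xs) → x < y → length xs ≡ length ys →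
                   colexRank (x ∷ xs) < colexRank (y ∷ ys)
colexRank-<-head {x} {y} {xs} {ys} (x>xs ∷ xs↓) x<y |xs|≡|ys| = begin-strict
  colexRank (x ∷ xs)        <⟨ colexRank<C (x>xs ∷ xs↓) (≤-refl ∷ All.map m<n⇒m<1+n x>xs) ⟩
  suc x C suc (length xs)   ≤⟨ C-monoˡ-≤ (suc (length xs)) x<y ⟩
  y C suc (length xs)       ≡⟨ cong (λ l → y C suc l) |xs|≡|ys| ⟩
  y C suc (length ys)       ≤⟨ m≤m+n _ _ ⟩
  colexRank (y ∷ ys)        ∎
  where open ≤-Reasoning

colexRank-injective : ∀ {xs ys} → Descending xs → Descending ys → length xs ≡ length ys →
                      colexRank xs ≡ colexRank ys → xs ≡ ys
colexRank-injective {[]}     {[]}     _ _ _ _ = refl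
colexRank-injective {x ∷ xs} {y ∷ ys} xs↓ ys↓ |xs|≡|ys| eq with <-cmp x y
... | tri< x<y _ _ = contradiction eq (<⇒≢ (colexRank-<-head {ys = ys} xs↓ x<y (suc-injective |xs|≡|ys|)))
... | tri> _ _ y<x = contradiction eq (>⇒≢ (colexRank-<-head {ys = xs} ys↓ y<x (suc-injective (sym |xs|≡|ys|))))
... | tri≈ _ refl _ = cong (x ∷_) (colexRank-injective (AllPairs.tail xs↓) (AllPairs.tail ys↓) |xs|≡|ys|′
    (+-cancelˡ-≡ _ _ _ (trans eq (cong (λ l → x C suc l + colexRank ys) (sym |xs|≡|ys|′)))))
  where
  |xs|≡|ys|′ : length xs ≡ length ys
  |xs|≡|ys|′ = suc-injective |xs|≡|ys|

length-take≤ : ∀ {k} (xs : List ℕ) → k ≤ length xs → length (take k xs) ≡ k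
length-take≤ {k} xs k≤ = trans (length-take k xs) (m≤n⇒m⊓n≡m k≤)

⊆⇒colexRank<take⊎prefix : ∀ {xs ys} → Descending ys → xs ⊆ ys →
  colexRank xs < colexRank (take (length xs) ys) ⊎ ∃[ zs ] ys ≡ xs ++ zs
⊆⇒colexRank<take⊎prefix {ys = ys} _ [] = inj₂ (ys , refl)
⊆⇒colexRank<take⊎prefix {[]} {ys} _ (_ ∷ʳ _) = inj₂ (ys , refl)
⊆⇒colexRank<take⊎prefix {x ∷ xs} {y ∷ ys} (y>ys ∷ ys↓) (.y ∷ʳ x∷xs⊆ys) = inj₁ (begin-strict
  colexRank (x ∷ xs)                       <⟨ colexRank<C (Descending-resp-⊆ x∷xs⊆ys ys↓) (All-resp-⊆ x∷xs⊆ys y>ys) ⟩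
  y C suc (length xs)                      ≡⟨ cong (λ l → y C suc l) (sym (length-take≤ ys (<⇒≤ (length-mono-≤ x∷xs⊆ys)))) ⟩
  y C suc (length (take (length xs) ys))   ≤⟨ m≤m+n _ _ ⟩
  colexRank (y ∷ take (length xs) ys)      ∎)
  where open ≤-Reasoning
⊆⇒colexRank<take⊎prefix {x ∷ xs} {.x ∷ ys} (_ ∷ ys↓) (refl ∷ xs⊆ys)
  with ⊆⇒colexRank<take⊎prefix ys↓ xs⊆ys
... | inj₂ (zs , ys≡) = inj₂ (zs , cong (x ∷_) ys≡)
... | inj₁ lt = inj₁ (subst (λ l → x C suc (length xs) + colexRank xs < x C suc l + colexRank (take (length xs) ys))
                            (sym (length-take≤ ys (length-mono-≤ xs⊆ys)))
                            (+-monoʳ-< _ lt))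

length-take-downFrom : ∀ {p c} → p ≤ c → length (take p (downFrom c)) ≡ p
length-take-downFrom {p} {c} p≤c = length-take≤ (downFrom c) (subst (p ≤_) (sym (length-downFrom c)) p≤c)

length-++-take-downFrom : ∀ hs {p c} → p ≤ c → length (hs ++ take p (downFrom c)) ≡ length hs + p
length-++-take-downFrom hs p≤c = trans (length-++ hs) (cong (length hs +_) (length-take-downFrom p≤c))

Descending-take-downFrom : ∀ p c → Descending (take p (downFrom c))
Descending-take-downFrom p c = AllPairs.take⁺ p (Descending-downFrom c)

All<-take-downFrom : ∀ p c → All (_< c) (take p (downFrom c))
All<-take-downFrom p c = All.take⁺ p (All.applyDownFrom⁺₁ (λ i → i) c (λ i<c → i<c))

-- The hockey-stick identity Σ_{i<p} C(c−1−i, p−i) = C(c, p) − 1.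
suc-colexRank-take-downFrom : ∀ {p c} → p ≤ c → suc (colexRank (take p (downFrom c))) ≡ c C p
suc-colexRank-take-downFrom {zero}  {c}     _         = refl
suc-colexRank-take-downFrom {suc p} {suc c} (s≤s p≤c) = begin
  suc (c C suc (length (take p (downFrom c))) + colexRank (take p (downFrom c)))
    ≡⟨ cong (λ l → suc (c C suc l + colexRank (take p (downFrom c)))) (length-take-downFrom p≤c) ⟩
  suc (c C suc p + colexRank (take p (downFrom c)))   ≡⟨ sym (+-suc _ _) ⟩
  c C suc p + suc (colexRank (take p (downFrom c)))   ≡⟨ cong (c C suc p +_) (suc-colexRank-take-downFrom p≤c) ⟩
  c C suc p + c C p                                   ≡⟨ +-comm (c C suc p) _ ⟩
  c C p + c C suc p                                   ≡⟨ nCk+nC[k+1]≡[n+1]C[k+1] c p ⟩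
  suc c C suc p                                       ∎
  where open ≡-Reasoning

⊆⇒colexRank≤ : ∀ hs {ls xs c p} → Descending (hs ++ ls) → All (_< c) ls → p ≤ c →
  xs ⊆ hs ++ ls → length xs ≡ length hs + p → colexRank xs ≤ colexRank (hs ++ take p (downFrom c))
⊆⇒colexRank≤ [] {ls} {xs} {c} {p} ls↓ ls<c p≤c xs⊆ls |xs|≡p = ≤-pred (begin-strict
  colexRank xs                            <⟨ colexRank<C (Descending-resp-⊆ xs⊆ls ls↓) (All-resp-⊆ xs⊆ls ls<c) ⟩
  c C length xs                           ≡⟨ cong (c C_) |xs|≡p ⟩
  c C p                                   ≡⟨ sym (suc-colexRank-take-downFrom p≤c) ⟩
  suc (colexRank (take p (downFrom c)))   ∎)
  where open ≤-Reasoning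
⊆⇒colexRank≤ (h ∷ hs) {ls} {xs} {c} {p} (h>hsls ∷ hsls↓) _ p≤c (.h ∷ʳ xs⊆) |xs|≡ = begin
  colexRank xs                                  ≤⟨ <⇒≤ (colexRank<C (Descending-resp-⊆ xs⊆ hsls↓) (All-resp-⊆ xs⊆ h>hsls)) ⟩
  h C length xs                                 ≡⟨ cong (h C_) (trans |xs|≡ (cong suc (sym |hs++top|))) ⟩
  h C suc (length (hs ++ take p (downFrom c)))  ≤⟨ m≤m+n _ _ ⟩
  colexRank (h ∷ hs ++ take p (downFrom c))     ∎
  where
  open ≤-Reasoning
  |hs++top| : length (hs ++ take p (downFrom c)) ≡ length hs + p
  |hs++top| = length-++-take-downFrom hs p≤c
⊆⇒colexRank≤ (h ∷ hs) {ls} {h ∷ xs} {c} {p} (_ ∷ hsls↓) ls<c p≤c (refl ∷ xs⊆) |xs|≡ =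
  subst (λ l → h C suc (length xs) + colexRank xs ≤ h C suc l + colexRank (hs ++ take p (downFrom c)))
        (sym (trans (length-++-take-downFrom hs p≤c) (sym (suc-injective |xs|≡))))
        (+-monoʳ-≤ _ (⊆⇒colexRank≤ hs hsls↓ ls<c p≤c xs⊆ (suc-injective |xs|≡)))

-- The colex order on sets below a common bound

bfilter-++ : ∀ {A : Set} (p : A → Bool) xs ys → bfilter p (xs ++ ys) ≡ bfilter p xs ++ bfilter p ys
bfilter-++ p []       ys = refl
bfilter-++ p (x ∷ xs) ys with p x
... | true  = cong (x ∷_) (bfilter-++ p xs ys)
... | false = bfilter-++ p xs ys

bfilter⁺ : ∀ {A : Set} {P : A → Set} (p : A → Bool) {xs} → All P xs → All P (bfilter p xs)
bfilter⁺ p []                = []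
bfilter⁺ p {x ∷ _} (px ∷ pxs) with p x
... | true  = px ∷ bfilter⁺ p pxs
... | false = bfilter⁺ p pxs

bfilter-cong : ∀ {A : Set} {p q : A → Bool} {xs} → All (λ x → p x ≡ q x) xs → bfilter p xs ≡ bfilter q xs
bfilter-cong []                    = refl
bfilter-cong {q = q} {x ∷ _} (px≡qx ∷ eqs) rewrite px≡qx with q x
... | true  = cong (x ∷_) (bfilter-cong eqs)
... | false = bfilter-cong eqs

∈-bfilter⁺ : ∀ {A : Set} (p : A → Bool) {x : A} {xs} → x ∈ xs → p x ≡ true → x ∈ bfilter p xs
∈-bfilter⁺ p (here refl) px rewrite px = here refl
∈-bfilter⁺ p {xs = y ∷ _} (there x∈) px with p y
... | true  = there (∈-bfilter⁺ p x∈ px)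
... | false = ∈-bfilter⁺ p x∈ px

≢⇒≡ᵇ≡false : ∀ {x y} → x ≢ y → (x ≡ᵇ y) ≡ false
≢⇒≡ᵇ≡false {x} {y} x≢y with x ≡ᵇ y in eq
... | true  = contradiction (≡ᵇ⇒≡ x y (Equivalence.from T-≡ eq)) x≢y
... | false = refl

∈ᵇ-++ : ∀ x xs ys → x ∈ᵇ (xs ++ ys) ≡ (x ∈ᵇ xs) ∨ (x ∈ᵇ ys)
∈ᵇ-++ x []       ys = refl
∈ᵇ-++ x (y ∷ xs) ys = trans (cong ((x ≡ᵇ y) ∨_) (∈ᵇ-++ x xs ys)) (sym (∨-assoc (x ≡ᵇ y) _ _))

∉ᵇ-above : ∀ {y xs} → All (_< y) xs → y ∈ᵇ xs ≡ false
∉ᵇ-above []            = refl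
∉ᵇ-above (x<y ∷ xs<y) rewrite ≢⇒≡ᵇ≡false (>⇒≢ x<y) = ∉ᵇ-above xs<y

∈ᵇ-∷ʳ-< : ∀ {x y} xs → x < y → x ∈ᵇ (xs ++ [ y ]) ≡ x ∈ᵇ xs
∈ᵇ-∷ʳ-< {x} {y} xs x<y rewrite ∈ᵇ-++ x xs [ y ] | ≢⇒≡ᵇ≡false (<⇒≢ x<y) = ∨-identityʳ _

∈ᵇ-∷ʳ-self : ∀ y xs → y ∈ᵇ (xs ++ [ y ]) ≡ true
∈ᵇ-∷ʳ-self y xs rewrite ∈ᵇ-++ y xs [ y ] | Equivalence.to T-≡ (≡⇒≡ᵇ y y refl) = ∨-zeroʳ _

maxM-All : ∀ {P : ℕ → Set} {xs v} → All P xs → maxM xs ≡ just v → P v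
maxM-All {P} {x ∷ xs} (px ∷ pxs) eq with maxM xs in eq′
... | nothing with refl ← eq = px
... | just z  with refl ← eq with ⊔-sel x z
...   | inj₁ x⊔z≡x = subst P (sym x⊔z≡x) px
...   | inj₂ x⊔z≡z = subst P (sym x⊔z≡z) (maxM-All pxs eq′)

maxM-greatest : ∀ {xs y} → All (_≤ y) xs → y ∈ xs → maxM xs ≡ just y
maxM-greatest {x ∷ xs} (_ ∷ xs≤y) (here refl) with maxM xs in eq
... | nothing = refl
... | just z  = cong just (m≥n⇒m⊔n≡m (maxM-All xs≤y eq))
maxM-greatest {x ∷ xs} (x≤y ∷ xs≤y) (there y∈) rewrite maxM-greatest xs≤y y∈ = cong just (m≤n⇒m⊔n≡n x≤y)

symdiff⁺ : ∀ {P : ℕ → Set} {A B} → All P A → All P B → All P (symdiff A B)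
symdiff⁺ pA pB = All.++⁺ (bfilter⁺ _ pA) (bfilter⁺ _ pB)

colexLt-max : ∀ A B {y} → maxM (symdiff A B) ≡ just y → colexLt A B ≡ y ∈ᵇ B
colexLt-max A B eq with maxM (symdiff A B)
colexLt-max A B refl | just _ = refl

symdiff-∷ʳ-∷ʳ : ∀ {y A B} → All (_< y) A → All (_< y) B → symdiff (A ++ [ y ]) (B ++ [ y ]) ≡ symdiff A B
symdiff-∷ʳ-∷ʳ {y} {A} {B} A<y B<y = cong₂ _++_ (drop-y A B B<y A<y) (drop-y B A A<y B<y)
  where
  drop-y : ∀ X Y → All (_< y) Y → All (_< y) X →
           bfilter (λ x → not (x ∈ᵇ (Y ++ [ y ]))) (X ++ [ y ]) ≡ bfilter (λ x → not (x ∈ᵇ Y)) X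
  drop-y X Y _ X<y rewrite bfilter-++ (λ x → not (x ∈ᵇ (Y ++ [ y ]))) X [ y ] | ∈ᵇ-∷ʳ-self y Y
    = trans (++-identityʳ _) (bfilter-cong (All.map (λ x<y → cong not (∈ᵇ-∷ʳ-< Y x<y)) X<y))

colexLt-∷ʳ-∷ʳ : ∀ {y A B} → All (_< y) A → All (_< y) B → colexLt (A ++ [ y ]) (B ++ [ y ]) ≡ colexLt A B
colexLt-∷ʳ-∷ʳ {y} {A} {B} A<y B<y rewrite symdiff-∷ʳ-∷ʳ A<y B<y with maxM (symdiff A B) in eq
... | nothing = refl
... | just v  = ∈ᵇ-∷ʳ-< B (maxM-All (symdiff⁺ A<y B<y) eq)

colexLt-∷ʳ-below : ∀ {y A B} → All (_< y) A → All (_< y) B → ¬ T (colexLt (A ++ [ y ]) B)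
colexLt-∷ʳ-below {y} {A} {B} A<y B<y =
  subst T (trans (colexLt-max (A ++ [ y ]) B (maxM-greatest sd≤y y∈sd)) (∉ᵇ-above B<y))
  where
  sd≤y : All (_≤ y) (symdiff (A ++ [ y ]) B)
  sd≤y = symdiff⁺ (All.++⁺ (All.map <⇒≤ A<y) (≤-refl ∷ [])) (All.map <⇒≤ B<y)
  y∈sd : y ∈ symdiff (A ++ [ y ]) B
  y∈sd = ∈-++⁺ˡ (∈-bfilter⁺ _ (∈-++⁺ʳ A (here refl)) (cong not (∉ᵇ-above B<y)))

colexLt-below-∷ʳ : ∀ {y A B} → All (_< y) A → All (_< y) B → T (colexLt A (B ++ [ y ]))
colexLt-below-∷ʳ {y} {A} {B} A<y B<y =
  subst T (sym (trans (colexLt-max A (B ++ [ y ]) (maxM-greatest sd≤y y∈sd)) (∈ᵇ-∷ʳ-self y B))) _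
  where
  sd≤y : All (_≤ y) (symdiff A (B ++ [ y ]))
  sd≤y = symdiff⁺ (All.map <⇒≤ A<y) (All.++⁺ (All.map <⇒≤ B<y) (≤-refl ∷ []))
  y∈sd : y ∈ symdiff A (B ++ [ y ])
  y∈sd = ∈-++⁺ʳ _ (∈-bfilter⁺ _ (∈-++⁺ʳ B (here refl)) (cong not (∉ᵇ-above A<y)))

-- Counting subsets

count : {A : Set} → (A → Bool) → List A → ℕ
count p xs = length (bfilter p xs)

count-++ : ∀ {A : Set} (p : A → Bool) xs ys → count p (xs ++ ys) ≡ count p xs + count p ys
count-++ p xs ys = trans (cong length (bfilter-++ p xs ys)) (length-++ (bfilter p xs))

count-map : ∀ {A B : Set} (p : B → Bool) (f : A → B) xs → count p (map f xs) ≡ count (p ∘ f) xs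
count-map p f []       = refl
count-map p f (x ∷ xs) with p (f x)
... | true  = cong suc (count-map p f xs)
... | false = count-map p f xs

count-cong : ∀ {A : Set} {p q : A → Bool} {xs} → All (λ x → p x ≡ q x) xs → count p xs ≡ count q xs
count-cong = cong length ∘ bfilter-cong

count-true : ∀ {A : Set} {p : A → Bool} {xs} → All (T ∘ p) xs → count p xs ≡ length xs
count-true []                                = refl
count-true {p = p} {x ∷ _} (px ∷ pxs) with p x
... | true = cong suc (count-true pxs)

count-false : ∀ {A : Set} {p : A → Bool} {xs} → All (¬_ ∘ T ∘ p) xs → count p xs ≡ 0
count-false []                                 = refl
count-false {p = p} {x ∷ _} (¬px ∷ ¬pxs) with p x
... | true  = ⊥-elim (¬px _)
... | false = count-false ¬pxs

count-mono : ∀ {A : Set} {p q : A → Bool} {xs} → All (λ x → T (p x) → T (q x)) xs → count p xs ≤ count q xs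
count-mono [] = z≤n
count-mono {p = p} {q} {x ∷ _} (p⇒q ∷ pxs⇒qxs) with p x | q x | p⇒q
... | true  | true  | _   = s≤s (count-mono pxs⇒qxs)
... | true  | false | p⇒q = ⊥-elim (p⇒q _)
... | false | true  | _   = m≤n⇒m≤1+n (count-mono pxs⇒qxs)
... | false | false | _   = count-mono pxs⇒qxs

count-mono-< : ∀ {A : Set} {p q : A → Bool} {xs y} → All (λ x → T (p x) → T (q x)) xs →
               y ∈ xs → ¬ T (p y) → T (q y) → count p xs < count q xs
count-mono-< {p = p} {q} {x ∷ _} (_ ∷ pxs⇒qxs) (here refl) ¬py qy with p x | q x
... | true  | _     = ⊥-elim (¬py _)
... | false | true  = s≤s (count-mono pxs⇒qxs)
... | false | false = ⊥-elim qy
count-mono-< {p = p} {q} {x ∷ _} (p⇒q ∷ pxs⇒qxs) (there y∈) ¬py qy with p x | q x | p⇒q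
... | true  | true  | _   = s≤s (count-mono-< pxs⇒qxs y∈ ¬py qy)
... | true  | false | p⇒q = ⊥-elim (p⇒q _)
... | false | true  | _   = m<n⇒m<1+n (count-mono-< pxs⇒qxs y∈ ¬py qy)
... | false | false | _   = count-mono-< pxs⇒qxs y∈ ¬py qy

length-subsets : ∀ k (xs : List ℕ) → length (subsets k xs) ≡ length xs C k
length-subsets zero    xs       = refl
length-subsets (suc k) []       = refl
length-subsets (suc k) (x ∷ xs) = begin
  length (map (x ∷_) (subsets k xs) ++ subsets (suc k) xs)
    ≡⟨ length-++ (map (x ∷_) (subsets k xs)) ⟩
  length (map (x ∷_) (subsets k xs)) + length (subsets (suc k) xs)
    ≡⟨ cong₂ _+_ (trans (length-map (x ∷_) (subsets k xs)) (length-subsets k xs)) (length-subsets (suc k) xs) ⟩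
  length xs C k + length xs C suc k
    ≡⟨ nCk+nC[k+1]≡[n+1]C[k+1] (length xs) k ⟩
  suc (length xs) C suc k ∎
  where open ≡-Reasoning

∈-subsets⁺ : ∀ {xs ys : List ℕ} → xs ⊆ ys → xs ∈ subsets (length xs) ys
∈-subsets⁺ []                            = here refl
∈-subsets⁺ {[]}     (_ ∷ʳ _)             = here refl
∈-subsets⁺ {_ ∷ xs} {y ∷ ys} (.y ∷ʳ xs⊆) = ∈-++⁺ʳ (map (y ∷_) (subsets (length xs) ys)) (∈-subsets⁺ xs⊆)
∈-subsets⁺ {x ∷ _}  (refl ∷ xs⊆)         = ∈-++⁺ˡ (∈-map⁺ (x ∷_) (∈-subsets⁺ xs⊆))

∈-subsets⁻ : ∀ k {xs} (ys : List ℕ) → xs ∈ subsets k ys → xs ⊆ ys × length xs ≡ k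
∈-subsets⁻ zero    ys       (here refl) = minimum ys , refl
∈-subsets⁻ (suc k) (y ∷ ys) xs∈ with ∈-++⁻ (map (y ∷_) (subsets k ys)) xs∈
... | inj₂ xs∈′ with ∈-subsets⁻ (suc k) ys xs∈′
...   | xs⊆ , |xs| = y ∷ʳ xs⊆ , |xs|
∈-subsets⁻ (suc k) (y ∷ ys) xs∈ | inj₁ xs∈′ with ∈-map⁻ (y ∷_) xs∈′
...   | _ , xs′∈ , refl with ∈-subsets⁻ k ys xs′∈
...     | xs′⊆ , |xs′| = refl ∷ xs′⊆ , cong suc |xs′|

count-subsets-∷ʳ : ∀ (p : List ℕ → Bool) k xs y →
  count p (subsets (suc k) (xs ++ [ y ])) ≡ count p (subsets (suc k) xs) + count (p ∘ (_++ [ y ])) (subsets k xs)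
count-subsets-∷ʳ p zero    []       y with p [ y ]
... | true  = refl
... | false = refl
count-subsets-∷ʳ p (suc k) []       y = refl
count-subsets-∷ʳ p k       (x ∷ xs) y = begin
  count p (map (x ∷_) (subsets k (xs ++ [ y ])) ++ subsets (suc k) (xs ++ [ y ]))
    ≡⟨ count-++ p (map (x ∷_) (subsets k (xs ++ [ y ]))) _ ⟩
  count p (map (x ∷_) (subsets k (xs ++ [ y ]))) + count p (subsets (suc k) (xs ++ [ y ]))
    ≡⟨ cong₂ _+_ (count-map p (x ∷_) (subsets k (xs ++ [ y ]))) (count-subsets-∷ʳ p k xs y) ⟩
  count (p ∘ (x ∷_)) (subsets k (xs ++ [ y ])) + (count p (subsets (suc k) xs) + count (p ∘ (_++ [ y ])) (subsets k xs))
    ≡⟨ sets-through-x k ⟩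
  count p (map (x ∷_) (subsets k xs)) + count p (subsets (suc k) xs) + count (p ∘ (_++ [ y ])) (subsets k (x ∷ xs))
    ≡⟨ cong (_+ count (p ∘ (_++ [ y ])) (subsets k (x ∷ xs))) (count-++ p (map (x ∷_) (subsets k xs)) _) ⟨
  count p (map (x ∷_) (subsets k xs) ++ subsets (suc k) xs) + count (p ∘ (_++ [ y ])) (subsets k (x ∷ xs)) ∎
  where
  open ≡-Reasoning
  sets-through-x : ∀ k →
    count (p ∘ (x ∷_)) (subsets k (xs ++ [ y ])) +
      (count p (subsets (suc k) xs) + count (p ∘ (_++ [ y ])) (subsets k xs))
    ≡ count p (map (x ∷_) (subsets k xs)) + count p (subsets (suc k) xs) +
      count (p ∘ (_++ [ y ])) (subsets k (x ∷ xs))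
  sets-through-x zero rewrite count-map p (x ∷_) [ [] ] = sym (+-assoc (count (p ∘ (x ∷_)) [ [] ]) _ _)
  sets-through-x (suc k)
    rewrite count-subsets-∷ʳ (p ∘ (x ∷_)) k xs y
          | count-map p (x ∷_) (subsets (suc k) xs)
          | count-++ (p ∘ (_++ [ y ])) (map (x ∷_) (subsets k xs)) (subsets (suc k) xs)
          | count-map (p ∘ (_++ [ y ])) (x ∷_) (subsets k xs)
    = +-interchange (count (p ∘ (x ∷_)) (subsets (suc k) xs)) (count (p ∘ (x ∷_) ∘ (_++ [ y ])) (subsets k xs))
                    (count p (subsets (suc (suc k)) xs)) (count (p ∘ (_++ [ y ])) (subsets (suc k) xs))

All-reverse⁺ : ∀ {P : ℕ → Set} {xs} → All P xs → All P (reverse xs)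
All-reverse⁺ {xs = xs} = All-resp-↭ (↭-sym (↭-reverse xs))

subsets-upTo-All< : ∀ k n → All (All (_< n)) (subsets k (upTo n))
subsets-upTo-All< k n = All.tabulate (λ B∈ → All-resp-⊆ (proj₁ (∈-subsets⁻ k (upTo n) B∈)) (all-upTo n))

count-colexLt-subsets : ∀ N {xs} → Descending xs → All (_< N) xs →
  count (λ B → colexLt B (reverse xs)) (subsets (length xs) (upTo N)) ≡ colexRank xs
count-colexLt-subsets N       {[]}     _ _ = refl
count-colexLt-subsets (suc n) {x ∷ xs} (x>xs ∷ xs↓) (x<1+n ∷ _) = begin
  count (λ B → colexLt B (reverse (x ∷ xs))) (subsets (suc k) (upTo (suc n)))
    ≡⟨ cong₂ (λ r u → count (λ B → colexLt B r) (subsets (suc k) u)) (unfold-reverse x xs) (sym (upTo-∷ʳ n)) ⟩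
  count (λ B → colexLt B (reverse xs ++ [ x ])) (subsets (suc k) (upTo n ++ [ n ]))
    ≡⟨ count-subsets-∷ʳ (λ B → colexLt B (reverse xs ++ [ x ])) k (upTo n) n ⟩
  count (λ B → colexLt B (reverse xs ++ [ x ])) (subsets (suc k) (upTo n)) +
  count (λ B → colexLt (B ++ [ n ]) (reverse xs ++ [ x ])) (subsets k (upTo n))
    ≡⟨ by-max (m≤n⇒m<n∨m≡n (≤-pred x<1+n)) ⟩
  x C suc k + colexRank xs ∎
  where
  open ≡-Reasoning
  k : ℕ
  k = length xs
  -- If x < n, no set containing n precedes x ∷ xs; if x = n, every set avoiding n does, and
  -- the sets containing n compare as they do after removing n.
  by-max : x < n ⊎ x ≡ n →
    count (λ B → colexLt B (reverse xs ++ [ x ])) (subsets (suc k) (upTo n)) +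
    count (λ B → colexLt (B ++ [ n ]) (reverse xs ++ [ x ])) (subsets k (upTo n))
    ≡ x C suc k + colexRank xs
  by-max (inj₁ x<n) = flip trans (+-identityʳ _) (cong₂ _+_
    (trans (cong (λ r → count (λ B → colexLt B r) (subsets (suc k) (upTo n))) (sym (unfold-reverse x xs)))
           (count-colexLt-subsets n (x>xs ∷ xs↓) (x<n ∷ xs<n)))
    (count-false (All.map (λ B<n → colexLt-∷ʳ-below B<n (All.++⁺ (All-reverse⁺ xs<n) (x<n ∷ [])))
                          (subsets-upTo-All< k n))))
    where
    xs<n : All (_< n) xs
    xs<n = All.map (λ y<x → <-trans y<x x<n) x>xs
  by-max (inj₂ refl) = cong₂ _+_
    (trans (count-true (All.map (λ B<n → colexLt-below-∷ʳ B<n (All-reverse⁺ x>xs)) (subsets-upTo-All< (suc k) n)))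
           (trans (length-subsets (suc k) (upTo n)) (cong (_C suc k) (length-upTo n))))
    (trans (count-cong (All.map (λ B<n → colexLt-∷ʳ-∷ʳ B<n (All-reverse⁺ x>xs)) (subsets-upTo-All< k n)))
           (count-colexLt-subsets n xs↓ x>xs))

⊆upTo⇒Descending-reverse : ∀ {xs n} → xs ⊆ upTo n → Descending (reverse xs)
⊆upTo⇒Descending-reverse {xs} {n} xs⊆ =
  Descending-resp-⊆ (subst (reverse xs ⊆_) (reverse-upTo n) (reverse⁺ xs⊆)) (Descending-downFrom n)

Descending⇒⊆downFrom : ∀ {xs n} → Descending xs → All (_< n) xs → xs ⊆ downFrom n
Descending⇒⊆downFrom {[]}     {n}     _ _ = minimum (downFrom n)
Descending⇒⊆downFrom {x ∷ xs} {suc n} (x>xs ∷ xs↓) (x<1+n ∷ _) with m≤n⇒m<n∨m≡n (≤-pred x<1+n)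
... | inj₁ x<n  = n ∷ʳ Descending⇒⊆downFrom (x>xs ∷ xs↓) (x<n ∷ All.map (λ y<x → <-trans y<x x<n) x>xs)
... | inj₂ refl = refl ∷ Descending⇒⊆downFrom xs↓ x>xs

Descending⇒reverse⊆upTo : ∀ {xs n} → Descending xs → All (_< n) xs → reverse xs ⊆ upTo n
Descending⇒reverse⊆upTo {xs} {n} xs↓ xs<n =
  subst (reverse xs ⊆_) (reverse-downFrom n) (reverse⁺ (Descending⇒⊆downFrom xs↓ xs<n))

≤maxℕ : ∀ xs → All (_≤ maxℕ xs) xs
≤maxℕ []       = []
≤maxℕ (x ∷ xs) = m≤m⊔n x (maxℕ xs) ∷ All.map (λ y≤ → ≤-trans y≤ (m≤n⊔m x (maxℕ xs))) (≤maxℕ xs)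

rank≡colexRank : ∀ {xs} → Descending (reverse xs) → rank (length xs) xs ≡ colexRank (reverse xs)
rank≡colexRank {xs} xs↑ = begin
  count (λ B → colexLt B xs) (subsets (length xs) (upTo N))
    ≡⟨ cong₂ (λ r l → count (λ B → colexLt B r) (subsets l (upTo N)))
             (sym (reverse-involutive xs)) (sym (length-reverse xs)) ⟩
  count (λ B → colexLt B (reverse (reverse xs))) (subsets (length (reverse xs)) (upTo N))
    ≡⟨ count-colexLt-subsets N xs↑ (All-reverse⁺ (All.map s≤s (≤maxℕ xs))) ⟩
  colexRank (reverse xs) ∎
  where
  open ≡-Reasoning
  N : ℕ
  N = suc (maxℕ xs)

rank≡colexRank-⊆upTo : ∀ {s xs n} → xs ⊆ upTo n → length xs ≡ s → rank s xs ≡ colexRank (reverse xs)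
rank≡colexRank-⊆upTo {xs = xs} xs⊆ refl = rank≡colexRank {xs} (⊆upTo⇒Descending-reverse xs⊆)

-- Colex rank and cliques of C^(s)(m)

isCliqueC⁺ : ∀ s m {X} → (∀ {E} → E ⊆ X → length E ≡ s → rank s E < m) → T (isCliqueC s m X)
isCliqueC⁺ s m {X} edges =
  all⁻ (isEdgeC s m) (All.tabulate (λ E∈ → <⇒<ᵇ (uncurry edges (∈-subsets⁻ s X E∈))))

isCliqueC⁻ : ∀ s m {X E} → T (isCliqueC s m X) → E ⊆ X → length E ≡ s → rank s E < m
isCliqueC⁻ s m {X} {E} X-clique E⊆X refl =
  <ᵇ⇒< (rank s E) m (All.lookup (all⁺ (isEdgeC s m) (subsets s X) X-clique) (∈-subsets⁺ E⊆X))

isCliqueC-suc : ∀ s m {X} → T (isCliqueC s m X) → T (isCliqueC s (suc m) X)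
isCliqueC-suc s m X-clique = isCliqueC⁺ s (suc m) (λ E⊆X |E| → m<n⇒m<1+n (isCliqueC⁻ s m X-clique E⊆X |E|))

C≤rank-++[max] : ∀ {xs y} → xs ⊆ upTo y → y C length (xs ++ [ y ]) ≤ rank (length (xs ++ [ y ])) (xs ++ [ y ])
C≤rank-++[max] {xs} {y} xs⊆ = begin
  y C length (xs ++ [ y ])              ≡⟨ cong (y C_) |xs++y| ⟩
  y C suc (length (reverse xs))         ≤⟨ m≤m+n _ _ ⟩
  colexRank (y ∷ reverse xs)            ≡⟨ cong colexRank (reverse-++ xs [ y ]) ⟨
  colexRank (reverse (xs ++ [ y ]))     ≡⟨ rank≡colexRank-⊆upTo xs++y⊆ refl ⟨
  rank (length (xs ++ [ y ])) (xs ++ [ y ]) ∎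
  where
  open ≤-Reasoning
  xs++y⊆ : xs ++ [ y ] ⊆ upTo (suc y)
  xs++y⊆ = subst (xs ++ [ y ] ⊆_) (upTo-∷ʳ y) (++⁺ xs⊆ ⊆-refl)
  |xs++y| : length (xs ++ [ y ]) ≡ suc (length (reverse xs))
  |xs++y| = trans (sym (length-reverse (xs ++ [ y ]))) (cong length (reverse-++ xs [ y ]))

colexRank-top≤ : ∀ s m {X n} → X ⊆ upTo n → s ≤ length X → T (isCliqueC s (suc m) X) →
  colexRank (take s (reverse X)) ≤ m
colexRank-top≤ s m {X} X⊆ s≤|X| clique = ≤-pred (begin-strict
  colexRank (take s (reverse X))   ≡⟨ cong colexRank (reverse-involutive (take s (reverse X))) ⟨
  colexRank (reverse top)          ≡⟨ rank≡colexRank-⊆upTo (⊆-trans top⊆X X⊆) |top| ⟨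
  rank s top                       <⟨ isCliqueC⁻ s (suc m) clique top⊆X |top| ⟩
  suc m                            ∎)
  where
  open ≤-Reasoning
  top : List ℕ
  top = reverse (take s (reverse X))
  top⊆X : top ⊆ X
  top⊆X = subst (top ⊆_) (reverse-involutive X) (reverse⁺ (take-⊆ s (reverse X)))
  |top| : length top ≡ s
  |top| = trans (length-reverse (take s (reverse X)))
                (length-take≤ (reverse X) (subst (s ≤_) (sym (length-reverse X)) s≤|X|))

¬isCliqueC-++[large] : ∀ s m {X y} → s ≤ length X → m + suc s ≤ y → X ⊆ upTo y →
  ¬ T (isCliqueC (suc s) m (X ++ [ y ]))
¬isCliqueC-++[large] s m {X} {y} s≤|X| m+s<y X⊆ clique = <-asym (isCliqueC⁻ (suc s) m clique E⊆ |E|) (begin-strict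
  m                                  <⟨ m<[m+k]Ck m (s≤s z≤n) ⟩
  (m + suc s) C suc s                ≤⟨ C-monoˡ-≤ (suc s) m+s<y ⟩
  y C suc s                          ≡⟨ cong (y C_) |E| ⟨
  y C length E                       ≤⟨ C≤rank-++[max] (⊆-trans (take-⊆ s X) X⊆) ⟩
  rank (length E) E                  ≡⟨ cong (λ l → rank l E) |E| ⟩
  rank (suc s) E                     ∎)
  where
  open ≤-Reasoning
  E : List ℕ
  E = take s X ++ [ y ]
  E⊆ : E ⊆ X ++ [ y ]
  E⊆ = ++⁺ (take-⊆ s X) ⊆-refl
  |E| : length E ≡ suc s
  |E| = trans (length-++ (take s X)) (trans (cong (_+ 1) (length-take≤ X s≤|X|)) (+-comm s 1))

count-cliques-upTo-suc : ∀ {s t m n} → 1 ≤ s → s ≤ t → m + s ≤ n →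
  count (isCliqueC s m) (subsets t (upTo (suc n))) ≡ count (isCliqueC s m) (subsets t (upTo n))
count-cliques-upTo-suc {suc s} {suc t} {m} {n} (s≤s z≤n) (s≤s s≤t) m+s<n = begin
  count (isCliqueC (suc s) m) (subsets (suc t) (upTo (suc n)))
    ≡⟨ cong (λ u → count (isCliqueC (suc s) m) (subsets (suc t) u)) (upTo-∷ʳ n) ⟨
  count (isCliqueC (suc s) m) (subsets (suc t) (upTo n ++ [ n ]))
    ≡⟨ count-subsets-∷ʳ (isCliqueC (suc s) m) t (upTo n) n ⟩
  count (isCliqueC (suc s) m) (subsets (suc t) (upTo n)) + count (isCliqueC (suc s) m ∘ (_++ [ n ])) (subsets t (upTo n))
    ≡⟨ cong (count (isCliqueC (suc s) m) (subsets (suc t) (upTo n)) +_) (count-false (All.tabulate no-clique)) ⟩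
  count (isCliqueC (suc s) m) (subsets (suc t) (upTo n)) + 0
    ≡⟨ +-identityʳ _ ⟩
  count (isCliqueC (suc s) m) (subsets (suc t) (upTo n)) ∎
  where
  open ≡-Reasoning
  no-clique : ∀ {X} → X ∈ subsets t (upTo n) → ¬ T (isCliqueC (suc s) m (X ++ [ n ]))
  no-clique X∈ with ∈-subsets⁻ t (upTo n) X∈
  ... | X⊆ , |X| = ¬isCliqueC-++[large] s m (subst (s ≤_) (sym |X|) s≤t) m+s<n X⊆

count-cliques-upTo : ∀ {s t m n} → 1 ≤ s → s ≤ t → m + s ≤ n →
  count (isCliqueC s m) (subsets t (upTo n)) ≡ k[ t , s ] m
count-cliques-upTo {s} {t} {m} 1≤s s≤t m+s≤n = go (≤⇒≤′ m+s≤n)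
  where
  go : ∀ {n} → m + s ≤′ n → count (isCliqueC s m) (subsets t (upTo n)) ≡ k[ t , s ] m
  go ≤′-refl        = refl
  go (≤′-step m+s≤′n) = trans (count-cliques-upTo-suc 1≤s s≤t (≤′⇒≤ m+s≤′n)) (go m+s≤′n)

-- The edge of colex rank m

colexRank-cascade : ∀ j s (f : Fin (suc j) → ℕ) → j < s → s ∸ j ≤ f (fromℕ j) →
  suc (colexRank (tabulate (f ∘ inject₁) ++ take (s ∸ j) (downFrom (f (fromℕ j)))))
    ≡ sum (tabulate (λ i → f i C (s ∸ toℕ i)))
colexRank-cascade zero    s       f _         p≤c = trans (suc-colexRank-take-downFrom p≤c) (sym (+-identityʳ _))
colexRank-cascade (suc j) (suc s) f (s≤s j<s) p≤c = begin
  suc (f fzero C suc (length rest) + colexRank rest)  ≡⟨ cong (λ l → suc (f fzero C suc l + colexRank rest)) |rest| ⟩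
  suc (f fzero C suc s + colexRank rest)              ≡⟨ +-suc _ _ ⟨
  f fzero C suc s + suc (colexRank rest)              ≡⟨ cong (f fzero C suc s +_) (colexRank-cascade j s (f ∘ fsuc) j<s p≤c) ⟩
  f fzero C suc s + sum (tabulate (λ i → f (fsuc i) C (s ∸ toℕ i))) ∎
  where
  open ≡-Reasoning
  rest : List ℕ
  rest = tabulate (f ∘ fsuc ∘ inject₁) ++ take (s ∸ j) (downFrom (f (fsuc (fromℕ j))))
  |rest| : length rest ≡ s
  |rest| = trans (length-++-take-downFrom (tabulate (f ∘ fsuc ∘ inject₁)) p≤c)
                 (trans (cong (_+ (s ∸ j)) (length-tabulate _)) (m+[n∸m]≡n (<⇒≤ j<s)))

Descending-++-take-downFrom⇒length≤ : ∀ {p c R} → 1 ≤ p → p ≤ c → Descending (take p (downFrom c) ++ R) →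
  p + length R ≤ c
Descending-++-take-downFrom⇒length≤ {suc p} {suc c} {R} _ (s≤s p≤c) (c>rest ∷ rest↓) = begin
  suc p + length R                                 ≡⟨ cong suc (cong (_+ length R) (length-take-downFrom p≤c)) ⟨
  suc (length (take p (downFrom c)) + length R)    ≡⟨ cong suc (length-++ (take p (downFrom c))) ⟨
  suc (length (take p (downFrom c) ++ R))          ≤⟨ s≤s (Descending⇒length≤ rest↓ c>rest) ⟩
  suc c                                            ∎
  where open ≤-Reasoning

module Cascade (s t m j : ℕ) (ns : Fin (suc j) → ℕ) (s<t : s < t) (j<s : j < s)
  (ns-decreasing : ∀ i i′ → toℕ i < toℕ i′ → ns i′ < ns i)
  (ns-bound : ∀ i → s ∸ toℕ i ≤ ns i)
  (cascade : sum (tabulate (λ i → ns i C (s ∸ toℕ i))) ≡ suc m) where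

  c p : ℕ
  c = ns (fromℕ j)
  p = s ∸ j

  p≤c : p ≤ c
  p≤c = subst (λ i → s ∸ i ≤ c) (toℕ-fromℕ j) (ns-bound (fromℕ j))

  H : List ℕ
  H = tabulate (ns ∘ inject₁)

  -- block p, read as a decreasing list, is the edge of colex rank m; block (t ∸ j) is the new clique.
  block : ℕ → List ℕ
  block q = H ++ take q (downFrom c)

  colexRank-block-p : colexRank (block p) ≡ m
  colexRank-block-p = suc-injective (trans (colexRank-cascade j s ns j<s p≤c) cascade)

  length-block : ∀ {q} → q ≤ c → length (block q) ≡ j + q
  length-block {q} q≤c = trans (length-++-take-downFrom H q≤c) (cong (_+ q) (length-tabulate (ns ∘ inject₁)))

  length-block-p : length (block p) ≡ s
  length-block-p = trans (length-block p≤c) (m+[n∸m]≡n (<⇒≤ j<s))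

  H-decreasing : Descending H
  H-decreasing = AllPairs.tabulate⁺-< (λ {i} {i′} i<i′ →
    ns-decreasing (inject₁ i) (inject₁ i′) (subst₂ _<_ (sym (toℕ-inject₁ i)) (sym (toℕ-inject₁ i′)) i<i′))

  H>c : All (c <_) H
  H>c = All.tabulate⁺ (λ i →
    ns-decreasing (inject₁ i) (fromℕ j) (subst₂ _<_ (sym (toℕ-inject₁ i)) (sym (toℕ-fromℕ j)) (toℕ<n i)))

  Descending-block : ∀ q → Descending (block q)
  Descending-block q = AllPairs.++⁺ H-decreasing (Descending-take-downFrom q c)
    (All.map (λ c<h → All.map (λ x<c → <-trans x<c c<h) (All<-take-downFrom q c)) H>c)

  ns≤ns₀ : ∀ i → ns i ≤ ns fzero
  ns≤ns₀ fzero    = ≤-refl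
  ns≤ns₀ (fsuc i) = <⇒≤ (ns-decreasing fzero (fsuc i) z<s)

  block≤ns₀ : ∀ q → All (_≤ ns fzero) (block q)
  block≤ns₀ q = All.++⁺ (All.tabulate⁺ (ns≤ns₀ ∘ inject₁))
                        (All.map (λ x<c → <⇒≤ (<-≤-trans x<c (ns≤ns₀ (fromℕ j)))) (All<-take-downFrom q c))

  N : ℕ
  N = suc (m + s + ns fzero)

  1≤s : 1 ≤ s
  1≤s = ≤-trans (s≤s z≤n) j<s

  reverse-block⊆upTo : ∀ q → reverse (block q) ⊆ upTo N
  reverse-block⊆upTo q =
    Descending⇒reverse⊆upTo (Descending-block q) (All.map (λ x≤ → s≤s (≤-trans x≤ (m≤n+m _ _))) (block≤ns₀ q))

  k≡count : ∀ {m′} → m′ ≤ suc m → k[ t , s ] m′ ≡ count (isCliqueC s m′) (subsets t (upTo N))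
  k≡count m′≤1+m = sym (count-cliques-upTo 1≤s (<⇒≤ s<t) (≤-trans (+-monoˡ-≤ s m′≤1+m) (s≤s (m≤m+n _ _))))

  rank≤m : ∀ {q E} → q ≤ c → E ⊆ reverse (block q) → length E ≡ s → rank s E ≤ m
  rank≤m {q} {E} q≤c E⊆ |E| = begin
    rank s E               ≡⟨ rank≡colexRank-⊆upTo (⊆-trans E⊆ (reverse-block⊆upTo q)) |E| ⟩
    colexRank (reverse E)  ≤⟨ ⊆⇒colexRank≤ H (Descending-block q) (All<-take-downFrom q c) p≤c E↓⊆ |E↓| ⟩
    colexRank (block p)    ≡⟨ colexRank-block-p ⟩
    m                      ∎
    where
    open ≤-Reasoning
    E↓⊆ : reverse E ⊆ block q
    E↓⊆ = subst (reverse E ⊆_) (reverse-involutive (block q)) (reverse⁺ E⊆)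
    |E↓| : length (reverse E) ≡ length H + p
    |E↓| = trans (length-reverse E) (trans |E| (sym (trans (cong (_+ p) (length-tabulate _)) (m+[n∸m]≡n (<⇒≤ j<s)))))

  new-clique : t ≤ j + c → k[ t , s ] m < k[ t , s ] (suc m)
  new-clique t≤j+c = begin-strict
    k[ t , s ] m                                      ≡⟨ k≡count (n≤1+n m) ⟩
    count (isCliqueC s m) (subsets t (upTo N))        <⟨ count-mono-< (All.universal (λ _ → isCliqueC-suc s m) _)
                                                                       X∈ X-not-m-clique X-clique ⟩
    count (isCliqueC s (suc m)) (subsets t (upTo N))  ≡⟨ k≡count ≤-refl ⟨
    k[ t , s ] (suc m)                                ∎
    where
    open ≤-Reasoning
    q : ℕ
    q = t ∸ j
    q≤c : q ≤ c
    q≤c = m≤n+o⇒m∸n≤o t j t≤j+c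
    X : List ℕ
    X = reverse (block q)
    |X| : length X ≡ t
    |X| = trans (length-reverse (block q)) (trans (length-block q≤c) (m+[n∸m]≡n (<⇒≤ (<-trans j<s s<t))))
    X∈ : X ∈ subsets t (upTo N)
    X∈ = subst (λ l → X ∈ subsets l (upTo N)) |X| (∈-subsets⁺ (reverse-block⊆upTo q))
    A⊆X : reverse (block p) ⊆ X
    A⊆X = reverse⁺ (++⁺ (⊆-refl {x = H}) (take⁺ {xs = downFrom c} (∸-monoˡ-≤ j (<⇒≤ s<t))))
    |A| : length (reverse (block p)) ≡ s
    |A| = trans (length-reverse (block p)) length-block-p
    X-not-m-clique : ¬ T (isCliqueC s m X)
    X-not-m-clique clique = <-irrefl rank-A (isCliqueC⁻ s m clique A⊆X |A|)
      where
      rank-A : rank s (reverse (block p)) ≡ m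
      rank-A = trans (rank≡colexRank-⊆upTo (reverse-block⊆upTo p) |A|)
                     (trans (cong colexRank (reverse-involutive (block p))) colexRank-block-p)
    X-clique : T (isCliqueC s (suc m) X)
    X-clique = isCliqueC⁺ s (suc m) (λ E⊆X |E| → s≤s (rank≤m q≤c E⊆X |E|))

  -- An edge of rank m inside an (m+1)-clique X is the block of rank m, and it must be the
  -- top of X: a higher s-subset of X would have rank > m.  The rest of X then lies below c - p.
  clique-through-rank-m⇒t≤j+c : ∀ {X E} → X ⊆ upTo N → length X ≡ t → T (isCliqueC s (suc m) X) →
    E ⊆ X → length E ≡ s → rank s E ≡ m → t ≤ j + c
  clique-through-rank-m⇒t≤j+c {X} {E} X⊆N |X| clique E⊆X |E| rank-E
    with ⊆⇒colexRank<take⊎prefix (⊆upTo⇒Descending-reverse X⊆N) (reverse⁺ E⊆X)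
  ... | inj₁ E<top = ⊥-elim (<⇒≱ E<top (begin
    colexRank (take (length (reverse E)) (reverse X))  ≡⟨ cong (λ k → colexRank (take k (reverse X))) |E↓| ⟩
    colexRank (take s (reverse X))                     ≤⟨ colexRank-top≤ s m X⊆N s≤|X| clique ⟩
    m                                                  ≡⟨ trans (sym rank-E) (rank≡colexRank-⊆upTo (⊆-trans E⊆X X⊆N) |E|) ⟩
    colexRank (reverse E)                              ∎))
    where
    open ≤-Reasoning
    |E↓| : length (reverse E) ≡ s
    |E↓| = trans (length-reverse E) |E|
    s≤|X| : s ≤ length X
    s≤|X| = subst (_≤ length X) |E| (length-mono-≤ E⊆X)
  ... | inj₂ (R , X↓≡E↓++R) = begin
    t                                            ≡⟨ trans (sym |X|) (sym (length-reverse X)) ⟩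
    length (reverse X)                           ≡⟨ cong length X↓≡block++R ⟩
    length (H ++ (take p (downFrom c) ++ R))     ≡⟨ length-++ H ⟩
    length H + length (take p (downFrom c) ++ R) ≡⟨ cong₂ _+_ (length-tabulate (ns ∘ inject₁)) (length-++ (take p (downFrom c))) ⟩
    j + (length (take p (downFrom c)) + length R) ≡⟨ cong (λ l → j + (l + length R)) (length-take-downFrom p≤c) ⟩
    j + (p + length R)                           ≤⟨ +-monoʳ-≤ j (Descending-++-take-downFrom⇒length≤ 1≤p p≤c tail↓) ⟩
    j + c                                        ∎
    where
    open ≤-Reasoning
    1≤p : 1 ≤ p
    1≤p = m<n⇒0<n∸m j<s
    E↓≡block : reverse E ≡ block p
    E↓≡block = colexRank-injective (Descending-resp-⊆ (reverse⁺ E⊆X) (⊆upTo⇒Descending-reverse X⊆N))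
      (Descending-block p) (trans (length-reverse E) (trans |E| (sym length-block-p)))
      (trans (sym (rank≡colexRank-⊆upTo (⊆-trans E⊆X X⊆N) |E|)) (trans rank-E (sym colexRank-block-p)))
    X↓≡block++R : reverse X ≡ H ++ (take p (downFrom c) ++ R)
    X↓≡block++R = trans X↓≡E↓++R (trans (cong (_++ R) E↓≡block) (++-assoc H _ R))
    tail↓ : Descending (take p (downFrom c) ++ R)
    tail↓ = Descending-resp-⊆ (++⁺ˡ H ⊆-refl) (subst Descending X↓≡block++R (⊆upTo⇒Descending-reverse X⊆N))

  no-new-clique : ¬ t ≤ j + c → k[ t , s ] (suc m) ≤ k[ t , s ] m
  no-new-clique t≰j+c = begin
    k[ t , s ] (suc m)                                ≡⟨ k≡count ≤-refl ⟩
    count (isCliqueC s (suc m)) (subsets t (upTo N))  ≤⟨ count-mono (All.tabulate still-m-clique) ⟩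
    count (isCliqueC s m) (subsets t (upTo N))        ≡⟨ k≡count (n≤1+n m) ⟨
    k[ t , s ] m                                      ∎
    where
    open ≤-Reasoning
    still-m-clique : ∀ {X} → X ∈ subsets t (upTo N) → T (isCliqueC s (suc m) X) → T (isCliqueC s m X)
    still-m-clique {X} X∈ clique with ∈-subsets⁻ t (upTo N) X∈
    ... | X⊆N , |X| = isCliqueC⁺ s m edge<m
      where
      edge<m : ∀ {E} → E ⊆ X → length E ≡ s → rank s E < m
      edge<m E⊆X |E| with m≤n⇒m<n∨m≡n (≤-pred (isCliqueC⁻ s (suc m) clique E⊆X |E|))
      ... | inj₁ rank<m = rank<m
      ... | inj₂ rank≡m = contradiction (clique-through-rank-m⇒t≤j+c X⊆N |X| clique E⊆X |E| rank≡m) t≰j+c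

  theorem : k[ t , s ] m < k[ t , s ] (suc m) ⇔ t ≤ j + c
  theorem = mk⇔ (λ grows → decidable-stable (t ≤? j + c) (λ t≰ → <⇒≱ grows (no-new-clique t≰))) new-clique

theorem4p6 : (s t n m : ℕ) → 1 ≤ s → s < t → t ≤ n → 0 < m → m < n C s →
    (j : ℕ) → (ns : Fin (suc j) → ℕ) →
    suc j ≤ s →
    (∀ (i i′ : Fin (suc j)) → toℕ i < toℕ i′ → ns i′ < ns i) →
    (∀ (i : Fin (suc j)) → s ∸ toℕ i ≤ ns i) →
    sum (tabulate (λ i → ns i C (s ∸ toℕ i))) ≡ suc m →
    (k[ t , s ] m < k[ t , s ] (suc m) ⇔ t ≤ suc j + ns (fromℕ j) ∸ 1)
theorem4p6 s t n m _ s<t _ _ _ j ns j<s ns-decreasing ns-bound cascade =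
  Cascade.theorem s t m j ns s<t j<s ns-decreasing ns-bound cascade
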